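{- Let $A$ be an $\mathcal L_{\mathrm R}$-sentence with $\mathsf{CR}^{+}\vdash A$. Then for every pole $\perp\!\!\!\perp$, $\langle\mathbb N,\perp\!\!\!\perp,\mathbb T_{\perp\!\!\!\perp},\mathbb F_{\perp\!\!\!\perp}\rangle\models A$.
   Context: $\mathcal L$: language of $\mathsf{PA}$ with $\to,\forall,=$, constant $0$ and function symbols for all primitive recursive functions; fixed Gödel numbering. Pairing $\langle\cdot,\cdot\rangle$ with projections $(\cdot)_0,(\cdot)_1$; $e\cdot m\simeq n$ means the $e$-th partial recursive function on input $m$ halts with output $n$ (formalised as a $\Sigma^0_1$ formula). $\mathrm{Eq}(y,z)$ ($\Sigma^0_1$) says $y,z$ code closed terms of equal value; $\mathrm{Sent}_{\mathcal L}$, quantifiers $\forall\ulcorner s\urcorner$ (closed terms), $\forall\ulcorner A_x\urcorner\in\mathrm{Sent}_{\mathcal L}$ (formulas with at most $x$ free), $\ulcorner A(\dot x)\urcorner$ (code of $A(\bar n)$, $n$ the value of $x$). A pole is $\perp\!\!\!\perp\subseteq\mathbb N$ such that if $e\cdot m\simeq n$ and $n\in\perp\!\!\!\perp$ then $\langle e,m\rangle\in\perp\!\!\!\perp$. For an $\mathcal L$-sentence $A$: $\lVert s=t\rVert_{\perp\!\!\!\perp}=\mathbb N$ if $s=t$ is false in $\mathbb N$, else $\perp\!\!\!\perp$; $\lVert A\to B\rVert=\{n:(n)_0\in|A|,(n)_1\in\lVert B\rVert\}$; $\lVert\forall xA\rVert=\{n:(n)_1\in\lVert A(\overline{(n)_0})\rVert\}$;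 $|A|_{\perp\!\!\!\perp}=\{n:\forall m\in\lVert A\rVert,\langle n,m\rangle\in\perp\!\!\!\perp\}$. $\mathbb T_{\perp\!\!\!\perp}=\{(n,\ulcorner A\urcorner):n\in|A|_{\perp\!\!\!\perp}\}$ and $\mathbb F_{\perp\!\!\!\perp}=\{(n,\ulcorner A\urcorner):n\in\lVert A\rVert_{\perp\!\!\!\perp}\}$ ($A$ ranging over $\mathcal L$-sentences) interpret $T$ and $F$; $\mathcal L$ is interpreted standardly and $\in\perp\!\!\!\perp$ by the pole. $\mathsf{CR}$: in $\mathcal L_{\mathrm R}=\mathcal L\cup\{\in\perp\!\!\!\perp,F,T\}$, $\mathsf{PA}$ with full induction plus universal closures of: $x\cdot y\simeq z\to(z\in\perp\!\!\!\perp\to\langle x,y\rangle\in\perp\!\!\!\perp)$; $\forall\ulcorner A\urcorner\in\mathrm{Sent}_{\mathcal L}.\ a\,T\,\ulcorner A\urcorner\leftrightarrow\forall b(b\,F\,\ulcorner A\urcorner\to\langle a,b\rangle\in\perp\!\!\!\perp)$; $\forall\ulcorner s\urcorner,\ulcorner t\urcorner.\ a\,F\,\ulcorner s=t\urcorner\leftrightarrow(\mathrm{Eq}(\ulcorner s\urcorner,\ulcorner t\urcorner)\to a\in\perp\!\!\!\perp)$; $\forall\ulcorner A\urcorner,\ulcorner B\urcorner\in\mathrm{Sent}_{\mathcal L}.\ a\,F\,\ulcorner A\to B\urcorner\leftrightarrow((a)_0\,T\,\ulcorner A\urcorner\wedge(a)_1\,F\,\ulcorner B\urcorner)$; $\forall\ulcorner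 A_x\urcorner\in\mathrm{Sent}_{\mathcal L}.\ a\,F\,\ulcorner\forall xA\urcorner\leftrightarrow(a)_1\,F\,\ulcorner A((\dot a)_0)\urcorner$. $\mathsf{CR}^{+}$ is $\mathsf{CR}$ plus the rule: from $s\,T\,\ulcorner A\urcorner$ infer $A$, for every closed term $s$ and $\mathcal L$-sentence $A$. -}

module Defs where

open import Data.Nat using (ℕ; zero; suc; _+_; _<_; _≟_)
open import Data.Fin using (Fin; toℕ; #_) renaming (zero to fz; suc to fs)
open import Data.Vec using (Vec; []; _∷_; lookup; map)
open import Data.Product using (Σ; _×_; _,_; proj₁; proj₂)
open import Data.Bool using (if_then_else_)
open import Data.Unit using (⊤)
open import Data.Empty using (⊥)
open import Relation.Nullary using (¬_)
open import Relation.Nullary.Decidable using (⌊_⌋)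
open import Relation.Binary.PropositionalEquality using (_≡_; _≢_)
open import Function.Bundles using (_⇔_)

tri : ℕ → ℕ
tri zero    = zero
tri (suc k) = tri k + suc k

⟨_,_⟩ : ℕ → ℕ → ℕ
⟨ x , y ⟩ = tri (x + y) + x

-- inverse of the pairing, by walking the Cantor enumeration
unpair : ℕ → ℕ × ℕ
unpair zero = 0 , 0
unpair (suc n) with unpair n
... | x , zero  = 0 , suc x
... | x , suc y = suc x , y

π₀ π₁ : ℕ → ℕ
π₀ n = proj₁ (unpair n)
π₁ n = proj₂ (unpair n)

data PR : ℕ → Set where
  Z : ∀ {n} → PR n
  S : PR 1
  P : ∀ {n} → Fin n → PR n
  C : ∀ {n k} → PR k → Vec (PR n) k → PR n
  R : ∀ {n} → PR n → PR (suc (suc n)) → PR (suc n)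

mutual
  evalPR : ∀ {n} → PR n → Vec ℕ n → ℕ
  evalPR Z xs = 0
  evalPR S (x ∷ []) = suc x
  evalPR (P i) xs = lookup xs i
  evalPR (C f gs) xs = evalPR f (evalPRs gs xs)
  evalPR (R g h) (y ∷ xs) = evalRec g h y xs

  evalPRs : ∀ {n k} → Vec (PR n) k → Vec ℕ n → Vec ℕ k
  evalPRs [] xs = []
  evalPRs (g ∷ gs) xs = evalPR g xs ∷ evalPRs gs xs

  evalRec : ∀ {n} → PR n → PR (suc (suc n)) → ℕ → Vec ℕ n → ℕ
  evalRec g h zero xs = evalPR g xs
  evalRec g h (suc y) xs = evalPR h (y ∷ evalRec g h y xs ∷ xs)

-- Gödel numbers of p.r. codes (arity recorded, so the coding is injective)
mutual
  codePR : ∀ {n} → PR n → ℕ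
  codePR {n} Z = ⟨ 0 , n ⟩
  codePR S = ⟨ 1 , 0 ⟩
  codePR {n} (P i) = ⟨ 2 , ⟨ n , toℕ i ⟩ ⟩
  codePR {n} (C f gs) = ⟨ 3 , ⟨ n , ⟨ codePR f , codePRs gs ⟩ ⟩ ⟩
  codePR (R g h) = ⟨ 4 , ⟨ codePR g , codePR h ⟩ ⟩

  codePRs : ∀ {n k} → Vec (PR n) k → ℕ
  codePRs [] = 0
  codePRs (g ∷ gs) = suc ⟨ codePR g , codePRs gs ⟩

-- Kleene application  e·m ≃ n  for a fixed (Kleene-normal-form) numbering
-- of the partial recursive functions: the index ⟨⌜t⌝,⌜u⌝⟩ denotes
-- m ↦ u(μw. t(m,w) = 0).

_·_≃_ : ℕ → ℕ → ℕ → Set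
e · m ≃ n =
  Σ (PR 2) λ t → Σ (PR 1) λ u → e ≡ ⟨ codePR t , codePR u ⟩ ×
  Σ ℕ λ w → evalPR t (m ∷ w ∷ []) ≡ 0 ×
            (∀ v → v < w → evalPR t (m ∷ v ∷ []) ≢ 0) ×
            evalPR u (w ∷ []) ≡ n

-- Syntax of L_R (de Bruijn variables; Term n / Fm n have n free variables)

data Term (n : ℕ) : Set where
  var : Fin n → Term n
  fn  : ∀ {k} → PR k → Vec (Term n) k → Term n

infixr 4 _⇒_
infix 6 _≐_ _𝐓_ _𝐅_

data Fm (n : ℕ) : Set where
  _≐_  : Term n → Term n → Fm n
  _⇒_  : Fm n → Fm n → Fm n
  ∀'   : Fm (suc n) → Fm n
  _∈⊥⊥ : Term n → Fm n
  _𝐓_  : Term n → Term n → Fm n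
  _𝐅_  : Term n → Term n → Fm n

data IsL {n : ℕ} : Fm n → Set where
  L≐ : ∀ {s t} → IsL (s ≐ t)
  L⇒ : ∀ {A B} → IsL A → IsL B → IsL (A ⇒ B)
  L∀ : ∀ {A} → IsL A → IsL (∀' A)

num : ∀ {n} → ℕ → Term n
num zero = fn Z []
num (suc k) = fn S (num k ∷ [])

mutual
  renT : ∀ {n m} → (Fin n → Fin m) → Term n → Term m
  renT r (var i) = var (r i)
  renT r (fn f ts) = fn f (renTs r ts)

  renTs : ∀ {n m k} → (Fin n → Fin m) → Vec (Term n) k → Vec (Term m) k
  renTs r [] = []
  renTs r (t ∷ ts) = renT r t ∷ renTs r ts

liftR : ∀ {n m} → (Fin n → Fin m) → Fin (suc n) → Fin (suc m)
liftR r fz = fz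
liftR r (fs i) = fs (r i)

ren : ∀ {n m} → (Fin n → Fin m) → Fm n → Fm m
ren r (s ≐ t) = renT r s ≐ renT r t
ren r (A ⇒ B) = ren r A ⇒ ren r B
ren r (∀' A) = ∀' (ren (liftR r) A)
ren r (t ∈⊥⊥) = renT r t ∈⊥⊥
ren r (s 𝐓 t) = renT r s 𝐓 renT r t
ren r (s 𝐅 t) = renT r s 𝐅 renT r t

mutual
  subT : ∀ {n m} → (Fin n → Term m) → Term n → Term m
  subT σ (var i) = σ i
  subT σ (fn f ts) = fn f (subTs σ ts)

  subTs : ∀ {n m k} → (Fin n → Term m) → Vec (Term n) k → Vec (Term m) k
  subTs σ [] = []
  subTs σ (t ∷ ts) = subT σ t ∷ subTs σ ts

liftS : ∀ {n m} → (Fin n → Term m) → Fin (suc n) → Term (suc m)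
liftS σ fz = var fz
liftS σ (fs i) = renT fs (σ i)

sub : ∀ {n m} → (Fin n → Term m) → Fm n → Fm m
sub σ (s ≐ t) = subT σ s ≐ subT σ t
sub σ (A ⇒ B) = sub σ A ⇒ sub σ B
sub σ (∀' A) = ∀' (sub (liftS σ) A)
sub σ (t ∈⊥⊥) = subT σ t ∈⊥⊥
sub σ (s 𝐓 t) = subT σ s 𝐓 subT σ t
sub σ (s 𝐅 t) = subT σ s 𝐅 subT σ t

wk : ∀ {n} → Fm n → Fm (suc n)
wk = ren fs

wk0 : ∀ {n} → Fm 0 → Fm n
wk0 = ren (λ ())

_[_] : ∀ {n} → Fm (suc n) → Term n → Fm n
A [ t ] = sub (λ { fz → t ; (fs i) → var i }) A

stepS : ∀ {n} → Fm (suc n) → Fm (suc n)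
stepS A = sub (λ { fz → fn S (var fz ∷ []) ; (fs i) → var (fs i) }) A

_⟦_⟧ : ∀ {k n} → Fm k → Vec (Term n) k → Fm n
A ⟦ ts ⟧ = sub (lookup ts) A

⊥̇ : ∀ {n} → Fm n
⊥̇ = num 0 ≐ num 1

¬̇_ : ∀ {n} → Fm n → Fm n
¬̇ A = A ⇒ ⊥̇

infixr 5 _∧̇_
infix 3 _⇔̇_
_∧̇_ : ∀ {n} → Fm n → Fm n → Fm n
A ∧̇ B = ¬̇ (A ⇒ ¬̇ B)

_⇔̇_ : ∀ {n} → Fm n → Fm n → Fm n
A ⇔̇ B = (A ⇒ B) ∧̇ (B ⇒ A)

mutual
  codeT : ∀ {n} → Term n → ℕ
  codeT (var i) = ⟨ 0 , toℕ i ⟩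
  codeT (fn f ts) = ⟨ 1 , ⟨ codePR f , codeTs ts ⟩ ⟩

  codeTs : ∀ {n k} → Vec (Term n) k → ℕ
  codeTs [] = 0
  codeTs (t ∷ ts) = suc ⟨ codeT t , codeTs ts ⟩

⌜_⌝ : ∀ {n} → Fm n → ℕ
⌜ s ≐ t ⌝ = ⟨ 0 , ⟨ codeT s , codeT t ⟩ ⟩
⌜ A ⇒ B ⌝ = ⟨ 1 , ⟨ ⌜ A ⌝ , ⌜ B ⌝ ⟩ ⟩
⌜ ∀' A ⌝ = ⟨ 2 , ⌜ A ⌝ ⟩
⌜ t ∈⊥⊥ ⌝ = ⟨ 3 , codeT t ⟩
⌜ s 𝐓 t ⌝ = ⟨ 4 , ⟨ codeT s , codeT t ⟩ ⟩
⌜ s 𝐅 t ⌝ = ⟨ 5 , ⟨ codeT s , codeT t ⟩ ⟩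

Env : ℕ → Set
Env n = Fin n → ℕ

ext : ∀ {n} → ℕ → Env n → Env (suc n)
ext k ρ fz = k
ext k ρ (fs i) = ρ i

mutual
  evalT : ∀ {n} → Term n → Env n → ℕ
  evalT (var i) ρ = ρ i
  evalT (fn f ts) ρ = evalPR f (evalTs ts ρ)

  evalTs : ∀ {n k} → Vec (Term n) k → Env n → Vec ℕ k
  evalTs [] ρ = []
  evalTs (t ∷ ts) ρ = evalT t ρ ∷ evalTs ts ρ

record Str : Set₁ where
  field
    Pol : ℕ → Set
    Tr  : ℕ → ℕ → Set
    Fa  : ℕ → ℕ → Set
open Str

Sat : ∀ {n} → Str → Fm n → Env n → Set
Sat M (s ≐ t) ρ = evalT s ρ ≡ evalT t ρ
Sat M (A ⇒ B) ρ = Sat M A ρ → Sat M B ρ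
Sat M (∀' A) ρ = (k : ℕ) → Sat M A (ext k ρ)
Sat M (t ∈⊥⊥) ρ = Pol M (evalT t ρ)
Sat M (s 𝐓 t) ρ = Tr M (evalT s ρ) (evalT t ρ)
Sat M (s 𝐅 t) ρ = Fa M (evalT s ρ) (evalT t ρ)

empty : Env 0
empty ()

IsPole : (ℕ → Set) → Set
IsPole Pl = ∀ e m n → e · m ≃ n → Pl n → Pl ⟨ e , m ⟩

module Realizability (Pl : ℕ → Set) where
  -- falsity value ‖A‖ (meaningful for L-formulas; junk ⊥ elsewhere)
  ‖_‖ : ∀ {n} → Fm n → Env n → ℕ → Set
  ‖ s ≐ t ‖ ρ k = if ⌊ evalT s ρ ≟ evalT t ρ ⌋ then Pl k else ⊤
  ‖ A ⇒ B ‖ ρ k = (∀ m → ‖ A ‖ ρ m → Pl ⟨ π₀ k , m ⟩) × ‖ B ‖ ρ (π₁ k)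
  ‖ ∀' A ‖ ρ k = ‖ A ‖ (ext (π₀ k) ρ) (π₁ k)
  ‖ t ∈⊥⊥ ‖ ρ k = ⊥
  ‖ s 𝐓 t ‖ ρ k = ⊥
  ‖ s 𝐅 t ‖ ρ k = ⊥

  ∣_∣ : ∀ {n} → Fm n → Env n → ℕ → Set
  ∣ A ∣ ρ k = ∀ m → ‖ A ‖ ρ m → Pl ⟨ k , m ⟩

  𝕋 𝔽 : ℕ → ℕ → Set
  𝕋 a c = Σ (Fm 0) λ A → IsL A × ⌜ A ⌝ ≡ c × ∣ A ∣ empty a
  𝔽 a c = Σ (Fm 0) λ A → IsL A × ⌜ A ⌝ ≡ c × ‖ A ‖ empty a

model : (ℕ → Set) → Str
model Pl = record { Pol = Pl ; Tr = Realizability.𝕋 Pl ; Fa = Realizability.𝔽 Pl }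

-- The arithmetisation used in the axioms of CR: p.r. function symbols and
-- L-formulas, each required to express the intended notion in ℕ.

record Arith : Set₁ where
  field
    pairC : PR 2
    fstC sndC : PR 1
    pairC-ok : ∀ x y → evalPR {2} pairC (x ∷ y ∷ []) ≡ ⟨ x , y ⟩
    fstC-ok  : ∀ x → evalPR {1} fstC (x ∷ []) ≡ π₀ x
    sndC-ok  : ∀ x → evalPR {1} sndC (x ∷ []) ≡ π₁ x
    eqC impC substC : PR 2
    allC : PR 1
    eqC-ok    : ∀ (s t : Term 0) → evalPR {2} eqC (codeT s ∷ codeT t ∷ []) ≡ ⌜ s ≐ t ⌝
    impC-ok   : ∀ (A B : Fm 0) → evalPR {2} impC (⌜ A ⌝ ∷ ⌜ B ⌝ ∷ []) ≡ ⌜ A ⇒ B ⌝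
    allC-ok   : ∀ (A : Fm 1) → evalPR {1} allC (⌜ A ⌝ ∷ []) ≡ ⌜ ∀' A ⌝
    substC-ok : ∀ (A : Fm 1) k → evalPR {2} substC (⌜ A ⌝ ∷ k ∷ []) ≡ ⌜ A [ num k ] ⌝
    appF : Fm 3
    appF-L : IsL appF
    appF-ok : ∀ M ρ → Sat M appF ρ ⇔ (ρ (# 0) · ρ (# 1) ≃ ρ (# 2))
    eqF : Fm 2
    eqF-L : IsL eqF
    eqF-ok : ∀ M ρ → Sat M eqF ρ ⇔
      (Σ (Term 0) λ s → Σ (Term 0) λ t →
         codeT s ≡ ρ (# 0) × codeT t ≡ ρ (# 1) × evalT s empty ≡ evalT t empty)
    ctmF : Fm 1
    ctmF-L : IsL ctmF
    ctmF-ok : ∀ M ρ → Sat M ctmF ρ ⇔ (Σ (Term 0) λ t → codeT t ≡ ρ (# 0))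
    sentF : Fm 1
    sentF-L : IsL sentF
    sentF-ok : ∀ M ρ → Sat M sentF ρ ⇔ (Σ (Fm 0) λ A → IsL A × ⌜ A ⌝ ≡ ρ (# 0))
    sent1F : Fm 1
    sent1F-L : IsL sent1F
    sent1F-ok : ∀ M ρ → Sat M sent1F ρ ⇔ (Σ (Fm 1) λ A → IsL A × ⌜ A ⌝ ≡ ρ (# 0))

module Theory (G : Arith) where
  open Arith G

  private
    v : ∀ {n} → Fin n → Term n
    v = var
    pr : ∀ {n} → Term n → Term n → Term n
    pr a b = fn pairC (a ∷ b ∷ [])
    p0 p1 : ∀ {n} → Term n → Term n
    p0 a = fn fstC (a ∷ [])
    p1 a = fn sndC (a ∷ [])

  data CRAx : Fm 0 → Set where
    ax-pole : CRAx (∀' (∀' (∀' (            -- x = 0, y = 1, z = 2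
      appF ⟦ v (# 0) ∷ v (# 1) ∷ v (# 2) ∷ [] ⟧ ⇒
        (v (# 2) ∈⊥⊥ ⇒ pr (v (# 0)) (v (# 1)) ∈⊥⊥)))))
    ax-T : CRAx (∀' (∀' (                   -- a = 0, ⌜A⌝ = 1
      sentF ⟦ v (# 1) ∷ [] ⟧ ⇒
        (v (# 0) 𝐓 v (# 1) ⇔̇
          ∀' (v (# 0) 𝐅 v (# 2) ⇒ pr (v (# 1)) (v (# 0)) ∈⊥⊥)))))   -- b = 0
    ax-F≐ : CRAx (∀' (∀' (∀' (              -- a = 0, ⌜s⌝ = 1, ⌜t⌝ = 2
      ctmF ⟦ v (# 1) ∷ [] ⟧ ⇒ (ctmF ⟦ v (# 2) ∷ [] ⟧ ⇒
        (v (# 0) 𝐅 fn eqC (v (# 1) ∷ v (# 2) ∷ []) ⇔̇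
          (eqF ⟦ v (# 1) ∷ v (# 2) ∷ [] ⟧ ⇒ v (# 0) ∈⊥⊥)))))))
    ax-F⇒ : CRAx (∀' (∀' (∀' (              -- a = 0, ⌜A⌝ = 1, ⌜B⌝ = 2
      sentF ⟦ v (# 1) ∷ [] ⟧ ⇒ (sentF ⟦ v (# 2) ∷ [] ⟧ ⇒
        (v (# 0) 𝐅 fn impC (v (# 1) ∷ v (# 2) ∷ []) ⇔̇
          (p0 (v (# 0)) 𝐓 v (# 1) ∧̇ p1 (v (# 0)) 𝐅 v (# 2))))))))
    ax-F∀ : CRAx (∀' (∀' (                  -- a = 0, ⌜A_x⌝ = 1
      sent1F ⟦ v (# 1) ∷ [] ⟧ ⇒
        (v (# 0) 𝐅 fn allC (v (# 1) ∷ []) ⇔̇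
          p1 (v (# 0)) 𝐅 fn substC (v (# 1) ∷ p0 (v (# 0)) ∷ [])))))

  data Ax (n : ℕ) : Fm n → Set where
    K      : ∀ A B → Ax n (A ⇒ B ⇒ A)
    Sax    : ∀ A B C' → Ax n ((A ⇒ B ⇒ C') ⇒ (A ⇒ B) ⇒ A ⇒ C')
    peirce : ∀ A B → Ax n (((A ⇒ B) ⇒ A) ⇒ A)
    efq    : ∀ A → Ax n (⊥̇ ⇒ A)
    inst   : ∀ A t → Ax n (∀' A ⇒ A [ t ])
    dist   : ∀ A B → Ax n (∀' (wk A ⇒ B) ⇒ A ⇒ ∀' B)
    refl≐  : ∀ t → Ax n (t ≐ t)
    leib   : ∀ A s t → Ax n (s ≐ t ⇒ A [ s ] ⇒ A [ t ])
    succ0  : ∀ t → Ax n (fn S (t ∷ []) ≐ num 0 ⇒ ⊥̇)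
    succI  : ∀ s t → Ax n (fn S (s ∷ []) ≐ fn S (t ∷ []) ⇒ s ≐ t)
    defZ   : ∀ {k} (ts : Vec (Term n) k) → Ax n (fn Z ts ≐ num 0)
    defP   : ∀ {k} (i : Fin k) ts → Ax n (fn (P i) ts ≐ lookup ts i)
    defC   : ∀ {k j} (f : PR j) (gs : Vec (PR k) j) ts →
             Ax n (fn (C f gs) ts ≐ fn f (map (λ g → fn g ts) gs))
    defR0  : ∀ {k} (g : PR k) h ts →
             Ax n (fn (R g h) (num 0 ∷ ts) ≐ fn g ts)
    defRS  : ∀ {k} (g : PR k) h t ts →
             Ax n (fn (R g h) (fn S (t ∷ []) ∷ ts) ≐ fn h (t ∷ fn (R g h) (t ∷ ts) ∷ ts))
    ind    : ∀ A → Ax n (A [ num 0 ] ⇒ ∀' (A ⇒ stepS A) ⇒ ∀' A)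
    cr     : ∀ {A} → CRAx A → Ax n (wk0 A)

  data _⊢_ : (n : ℕ) → Fm n → Set where
    ax   : ∀ {n A} → Ax n A → n ⊢ A
    mp   : ∀ {n A B} → n ⊢ (A ⇒ B) → n ⊢ A → n ⊢ B
    gen  : ∀ {n A} → suc n ⊢ A → n ⊢ ∀' A
    refl-rule : ∀ {n} (s : Term 0) (A : Fm 0) → IsL A →
                0 ⊢ (s 𝐓 num ⌜ A ⌝) → n ⊢ wk0 A

  CR⁺⊢ : Fm 0 → Set
  CR⁺⊢ A = 0 ⊢ A

-- Soundness by induction on derivations, for all poles at once.  Logic and PA
-- hold in every ℕ-structure.  The CR axioms hold in ⟨ℕ, ⊥⊥, 𝕋, 𝔽⟩ because
-- 𝕋 and 𝔽 are ∣_∣ and ‖_‖ read through the injective Gödel coding, so each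
-- axiom is a defining clause of ‖_‖ or ∣_∣ (or the closure property of a pole).
-- The reflection rule is where the quantification over poles is used: its
-- premise s T ⌜A⌝ also holds for the empty pole, and for the empty pole ‖A‖ is
-- inhabited exactly when the L-sentence A is false (classically), so a realizer
-- of A forces A to be true.
module Submission where

open import Defs
open import Level using (0ℓ)
open import Axiom.ExcludedMiddle using (ExcludedMiddle)
open import Axiom.DoubleNegationElimination using (em⇒dne)
open import Data.Bool using (if_then_else_)
open import Data.Empty using (⊥; ⊥-elim)
open import Data.Unit using (⊤; tt)
open import Data.Nat using (ℕ; zero; suc; _+_; _≟_)
open import Data.Nat.Properties using (+-suc; +-identityʳ; suc-injective)
open import Data.Fin using (Fin; toℕ; #_) renaming (zero to fz; suc to fs)
open import Data.Fin.Properties using (toℕ-injective)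
open import Data.Vec using (Vec; []; _∷_; lookup; map)
open import Data.Product using (Σ; _×_; _,_; proj₂)
open import Data.Product.Properties using (,-injective)
open import Data.Product.Function.NonDependent.Propositional using (_×-⇔_)
open import Function.Base using (_∋_; _∘_)
open import Function.Bundles using (_⇔_; mk⇔; Equivalence)
open import Function.Construct.Identity using (⇔-id)
open import Function.Construct.Symmetry using (⇔-sym)
open import Function.Construct.Composition using (_⇔-∘_)
open import Function.Related.TypeIsomorphisms using (→-cong-⇔)
import Function.Related.Propositional as Related
open import Relation.Nullary using (¬_; yes; no)
open import Relation.Nullary.Decidable using (⌊_⌋)
open import Relation.Binary.PropositionalEquality hiding ([_])

private
  variable
    n m : ℕ
    A : Fm n

cantor-next : ℕ × ℕ → ℕ × ℕ
cantor-next (x , zero)  = 0 , suc x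
cantor-next (x , suc y) = suc x , y

unpair-suc : ∀ k → unpair (suc k) ≡ cantor-next (unpair k)
unpair-suc k with unpair k
... | x , zero  = refl
... | x , suc y = refl

pair-sucˡ : ∀ x y → ⟨ suc x , y ⟩ ≡ suc ⟨ x , suc y ⟩
pair-sucˡ x y rewrite +-suc x y = +-suc (tri (suc (x + y))) x

pair-zero-suc : ∀ y → ⟨ 0 , suc y ⟩ ≡ suc ⟨ y , 0 ⟩
pair-zero-suc y rewrite +-identityʳ y | +-identityʳ (tri y + suc y) = +-suc (tri y) y

unpair-pair : ∀ x y → unpair ⟨ x , y ⟩ ≡ (x , y)
unpair-pair x y = along-diagonal (x + y) x y refl
  where
  open ≡-Reasoning
  along-diagonal : ∀ d x y → x + y ≡ d → unpair ⟨ x , y ⟩ ≡ (x , y)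
  along-diagonal _ zero zero _ = refl
  along-diagonal d (suc x) y x+y≡d = begin
    unpair ⟨ suc x , y ⟩                ≡⟨ cong unpair (pair-sucˡ x y) ⟩
    unpair (suc ⟨ x , suc y ⟩)           ≡⟨ unpair-suc ⟨ x , suc y ⟩ ⟩
    cantor-next (unpair ⟨ x , suc y ⟩)   ≡⟨ cong cantor-next (along-diagonal d x (suc y) x+[y+1]≡d) ⟩
    (suc x , y)                          ∎
    where x+[y+1]≡d = trans (+-suc x y) x+y≡d
  along-diagonal (suc d) zero (suc y) y+1≡d+1 = begin
    unpair ⟨ 0 , suc y ⟩                 ≡⟨ cong unpair (pair-zero-suc y) ⟩
    unpair (suc ⟨ y , 0 ⟩)               ≡⟨ unpair-suc ⟨ y , 0 ⟩ ⟩
    cantor-next (unpair ⟨ y , 0 ⟩)       ≡⟨ cong cantor-next (along-diagonal d y 0 y+0≡d) ⟩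
    (0 , suc y)                          ∎
    where y+0≡d = trans (+-identityʳ y) (suc-injective y+1≡d+1)

π₁-pair : ∀ x y → π₁ ⟨ x , y ⟩ ≡ y
π₁-pair x y = cong proj₂ (unpair-pair x y)

-- The arguments are explicit: ⟨_,_⟩ computes, so Agda cannot infer them.
⟨⟩-injective : ∀ a b c d → ⟨ a , b ⟩ ≡ ⟨ c , d ⟩ → a ≡ c × b ≡ d
⟨⟩-injective a b c d e = ,-injective (begin
  (a , b)            ≡⟨ unpair-pair a b ⟨
  unpair ⟨ a , b ⟩   ≡⟨ cong unpair e ⟩
  unpair ⟨ c , d ⟩   ≡⟨ unpair-pair c d ⟩
  (c , d)            ∎)
  where open ≡-Reasoning

-- Every code is ⟨ tag , payload ⟩.  Injectivity compares tags first, so only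
-- equal constructors need a clause; Agda's coverage checker refutes the rest.
tagPR payloadPR : PR n → ℕ
tagPR Z        = 0
tagPR S        = 1
tagPR (P i)    = 2
tagPR (C f gs) = 3
tagPR (R g h)  = 4
payloadPR {n} Z        = n
payloadPR     S        = 0
payloadPR {n} (P i)    = ⟨ n , toℕ i ⟩
payloadPR {n} (C f gs) = ⟨ n , ⟨ codePR f , codePRs gs ⟩ ⟩
payloadPR     (R g h)  = ⟨ codePR g , codePR h ⟩

unpair-codePR : (f : PR n) → unpair (codePR f) ≡ (tagPR f , payloadPR f)
unpair-codePR Z        = unpair-pair _ _
unpair-codePR S        = unpair-pair _ _
unpair-codePR (P i)    = unpair-pair _ _
unpair-codePR (C f gs) = unpair-pair _ _
unpair-codePR (R g h)  = unpair-pair _ _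

mutual
  codePR-injective : (f : PR n) (g : PR m) → codePR f ≡ codePR g → (Σ ℕ PR ∋ (n , f)) ≡ (m , g)
  codePR-injective f g e = same-layer f g
    (,-injective (trans (sym (unpair-codePR f)) (trans (cong unpair e) (unpair-codePR g))))
    where
    same-layer : (f : PR n) (g : PR m) → tagPR f ≡ tagPR g × payloadPR f ≡ payloadPR g →
                 (Σ ℕ PR ∋ (n , f)) ≡ (m , g)
    same-layer Z Z (refl , refl) = refl
    same-layer S S _ = refl
    same-layer (P {n} i) (P {m} j) (refl , e)
      with refl , i≡j ← ⟨⟩-injective n (toℕ i) m (toℕ j) e
      with refl ← toℕ-injective i≡j = refl
    same-layer (C {n} f gs) (C {m} f′ gs′) (refl , e)
      with refl , e′ ← ⟨⟩-injective n ⟨ codePR f , codePRs gs ⟩ m ⟨ codePR f′ , codePRs gs′ ⟩ e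
      with f≡f′ , gs≡gs′ ← ⟨⟩-injective (codePR f) (codePRs gs) (codePR f′) (codePRs gs′) e′
      with refl ← codePR-injective f f′ f≡f′
      with refl ← codePRs-injective gs gs′ gs≡gs′ = refl
    same-layer (R g h) (R g′ h′) (refl , e)
      with g≡g′ , h≡h′ ← ⟨⟩-injective (codePR g) (codePR h) (codePR g′) (codePR h′) e
      with refl ← codePR-injective g g′ g≡g′
      with refl ← codePR-injective h h′ h≡h′ = refl

  codePRs-injective : ∀ {k j} (gs : Vec (PR n) k) (hs : Vec (PR n) j) → codePRs gs ≡ codePRs hs →
                      (Σ ℕ (Vec (PR n)) ∋ (k , gs)) ≡ (j , hs)
  codePRs-injective [] [] _ = refl
  codePRs-injective (g ∷ gs) (h ∷ hs) e
    with g≡h , gs≡hs ← ⟨⟩-injective (codePR g) (codePRs gs) (codePR h) (codePRs hs) (suc-injective e)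
    with refl ← codePR-injective g h g≡h
    with refl ← codePRs-injective gs hs gs≡hs = refl

tagT payloadT : Term n → ℕ
tagT (var i)    = 0
tagT (fn f ts)  = 1
payloadT (var i)   = toℕ i
payloadT (fn f ts) = ⟨ codePR f , codeTs ts ⟩

unpair-codeT : (t : Term n) → unpair (codeT t) ≡ (tagT t , payloadT t)
unpair-codeT (var i)   = unpair-pair _ _
unpair-codeT (fn f ts) = unpair-pair _ _

mutual
  codeT-injective : (t u : Term n) → codeT t ≡ codeT u → t ≡ u
  codeT-injective t u e = same-layer t u
    (,-injective (trans (sym (unpair-codeT t)) (trans (cong unpair e) (unpair-codeT u))))
    where
    same-layer : (t u : Term n) → tagT t ≡ tagT u × payloadT t ≡ payloadT u → t ≡ u
    same-layer (var i) (var j) (refl , e) = cong var (toℕ-injective e)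
    same-layer (fn f ts) (fn g us) (refl , e)
      with f≡g , ts≡us ← ⟨⟩-injective (codePR f) (codeTs ts) (codePR g) (codeTs us) e
      with refl ← codePR-injective f g f≡g
      with refl ← codeTs-injective ts us ts≡us = refl

  codeTs-injective : ∀ {k j} (ts : Vec (Term n) k) (us : Vec (Term n) j) → codeTs ts ≡ codeTs us →
                     (Σ ℕ (Vec (Term n)) ∋ (k , ts)) ≡ (j , us)
  codeTs-injective [] [] _ = refl
  codeTs-injective (t ∷ ts) (u ∷ us) e
    with t≡u , ts≡us ← ⟨⟩-injective (codeT t) (codeTs ts) (codeT u) (codeTs us) (suc-injective e)
    with refl ← codeT-injective t u t≡u
    with refl ← codeTs-injective ts us ts≡us = refl

tagF payloadF : Fm n → ℕ
tagF (s ≐ t)  = 0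
tagF (A ⇒ B)  = 1
tagF (∀' A)   = 2
tagF (t ∈⊥⊥)  = 3
tagF (s 𝐓 t)  = 4
tagF (s 𝐅 t)  = 5
payloadF (s ≐ t) = ⟨ codeT s , codeT t ⟩
payloadF (A ⇒ B) = ⟨ ⌜ A ⌝ , ⌜ B ⌝ ⟩
payloadF (∀' A)  = ⌜ A ⌝
payloadF (t ∈⊥⊥) = codeT t
payloadF (s 𝐓 t) = ⟨ codeT s , codeT t ⟩
payloadF (s 𝐅 t) = ⟨ codeT s , codeT t ⟩

unpair-⌜⌝ : (A : Fm n) → unpair ⌜ A ⌝ ≡ (tagF A , payloadF A)
unpair-⌜⌝ (s ≐ t) = unpair-pair _ _
unpair-⌜⌝ (A ⇒ B) = unpair-pair _ _
unpair-⌜⌝ (∀' A)  = unpair-pair _ _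
unpair-⌜⌝ (t ∈⊥⊥) = unpair-pair _ _
unpair-⌜⌝ (s 𝐓 t) = unpair-pair _ _
unpair-⌜⌝ (s 𝐅 t) = unpair-pair _ _

⌜⌝-injective : (A B : Fm n) → ⌜ A ⌝ ≡ ⌜ B ⌝ → A ≡ B
⌜⌝-injective A B e = same-layer A B
  (,-injective (trans (sym (unpair-⌜⌝ A)) (trans (cong unpair e) (unpair-⌜⌝ B))))
  where
  codeT-pair-injective : (s t s′ t′ : Term n) →
                         ⟨ codeT s , codeT t ⟩ ≡ ⟨ codeT s′ , codeT t′ ⟩ → s ≡ s′ × t ≡ t′
  codeT-pair-injective s t s′ t′ e
    with s≡s′ , t≡t′ ← ⟨⟩-injective (codeT s) (codeT t) (codeT s′) (codeT t′) e =
    codeT-injective s s′ s≡s′ , codeT-injective t t′ t≡t′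

  same-layer : (A B : Fm n) → tagF A ≡ tagF B × payloadF A ≡ payloadF B → A ≡ B
  same-layer (s ≐ t) (s′ ≐ t′) (refl , e) with refl , refl ← codeT-pair-injective s t s′ t′ e = refl
  same-layer (A ⇒ B) (A′ ⇒ B′) (refl , e)
    with A≡A′ , B≡B′ ← ⟨⟩-injective ⌜ A ⌝ ⌜ B ⌝ ⌜ A′ ⌝ ⌜ B′ ⌝ e =
    cong₂ _⇒_ (⌜⌝-injective A A′ A≡A′) (⌜⌝-injective B B′ B≡B′)
  same-layer (∀' A) (∀' A′) (refl , e) = cong ∀' (⌜⌝-injective A A′ e)
  same-layer (t ∈⊥⊥) (t′ ∈⊥⊥) (refl , e) = cong _∈⊥⊥ (codeT-injective t t′ e)
  same-layer (s 𝐓 t) (s′ 𝐓 t′) (refl , e) with refl , refl ← codeT-pair-injective s t s′ t′ e = refl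
  same-layer (s 𝐅 t) (s′ 𝐅 t′) (refl , e) with refl , refl ← codeT-pair-injective s t s′ t′ e = refl

∀-cong-⇔ : {P Q : ℕ → Set} → (∀ k → P k ⇔ Q k) → (∀ k → P k) ⇔ (∀ k → Q k)
∀-cong-⇔ P⇔Q = mk⇔ (λ p k → Equivalence.to (P⇔Q k) (p k))
                    (λ q k → Equivalence.from (P⇔Q k) (q k))

cong-⇔ : (X : ℕ → Set) {x y : ℕ} → x ≡ y → X x ⇔ X y
cong-⇔ X refl = ⇔-id _

cong₂-⇔ : (X : ℕ → ℕ → Set) {x y u v : ℕ} → x ≡ y → u ≡ v → X x u ⇔ X y v
cong₂-⇔ X refl refl = ⇔-id _

evalS : ∀ {n m} → (Fin n → Term m) → Env m → Env n
evalS σ ρ i = evalT (σ i) ρ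

mutual
  evalT-renT : ∀ {r : Fin n → Fin m} {ρ ρ′} → ρ ∘ r ≗ ρ′ →
               ∀ t → evalT (renT r t) ρ ≡ evalT t ρ′
  evalT-renT ρr≗ρ′ (var i)   = ρr≗ρ′ i
  evalT-renT ρr≗ρ′ (fn f ts) = cong (evalPR f) (evalTs-renTs ρr≗ρ′ ts)

  evalTs-renTs : ∀ {r : Fin n → Fin m} {ρ ρ′} → ρ ∘ r ≗ ρ′ →
                 ∀ {k} (ts : Vec (Term n) k) → evalTs (renTs r ts) ρ ≡ evalTs ts ρ′
  evalTs-renTs ρr≗ρ′ []       = refl
  evalTs-renTs ρr≗ρ′ (t ∷ ts) = cong₂ _∷_ (evalT-renT ρr≗ρ′ t) (evalTs-renTs ρr≗ρ′ ts)

mutual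
  evalT-subT : ∀ {σ : Fin n → Term m} {ρ ρ′} → evalS σ ρ ≗ ρ′ →
               ∀ t → evalT (subT σ t) ρ ≡ evalT t ρ′
  evalT-subT σρ≗ρ′ (var i)   = σρ≗ρ′ i
  evalT-subT σρ≗ρ′ (fn f ts) = cong (evalPR f) (evalTs-subTs σρ≗ρ′ ts)

  evalTs-subTs : ∀ {σ : Fin n → Term m} {ρ ρ′} → evalS σ ρ ≗ ρ′ →
                 ∀ {k} (ts : Vec (Term n) k) → evalTs (subTs σ ts) ρ ≡ evalTs ts ρ′
  evalTs-subTs σρ≗ρ′ []       = refl
  evalTs-subTs σρ≗ρ′ (t ∷ ts) = cong₂ _∷_ (evalT-subT σρ≗ρ′ t) (evalTs-subTs σρ≗ρ′ ts)

ext-liftR : ∀ {r : Fin n → Fin m} {ρ ρ′} k → ρ ∘ r ≗ ρ′ → ext k ρ ∘ liftR r ≗ ext k ρ′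
ext-liftR k ρr≗ρ′ fz     = refl
ext-liftR k ρr≗ρ′ (fs i) = ρr≗ρ′ i

ext-liftS : ∀ {σ : Fin n → Term m} {ρ ρ′} k → evalS σ ρ ≗ ρ′ → evalS (liftS σ) (ext k ρ) ≗ ext k ρ′
ext-liftS k σρ≗ρ′ fz     = refl
ext-liftS {σ = σ} k σρ≗ρ′ (fs i) = trans (evalT-renT (λ _ → refl) (σ i)) (σρ≗ρ′ i)

evalT-num : ∀ k (ρ : Env n) → evalT (num k) ρ ≡ k
evalT-num zero    ρ = refl
evalT-num (suc k) ρ = cong suc (evalT-num k ρ)

lookup-evalTs : ∀ {k} (ts : Vec (Term n) k) (i : Fin k) ρ → lookup (evalTs ts ρ) i ≡ evalT (lookup ts i) ρ
lookup-evalTs (t ∷ ts) fz     ρ = refl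
lookup-evalTs (t ∷ ts) (fs i) ρ = lookup-evalTs ts i ρ

evalTs-map-fn : ∀ {k j} (gs : Vec (PR k) j) (ts : Vec (Term n) k) ρ →
                evalTs (map (λ g → fn g ts) gs) ρ ≡ evalPRs gs (evalTs ts ρ)
evalTs-map-fn []       ts ρ = refl
evalTs-map-fn (g ∷ gs) ts ρ = cong (evalPR g (evalTs ts ρ) ∷_) (evalTs-map-fn gs ts ρ)

module _ (M : Str) where
  open Str M

  sat-ren : ∀ {n m} {r : Fin n → Fin m} {ρ ρ′} → ρ ∘ r ≗ ρ′ → ∀ A → Sat M (ren r A) ρ ⇔ Sat M A ρ′
  sat-ren ρr≗ρ′ (s ≐ t)  = cong₂-⇔ _≡_ (evalT-renT ρr≗ρ′ s) (evalT-renT ρr≗ρ′ t)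
  sat-ren ρr≗ρ′ (A ⇒ B)  = →-cong-⇔ (sat-ren ρr≗ρ′ A) (sat-ren ρr≗ρ′ B)
  sat-ren ρr≗ρ′ (∀' A)   = ∀-cong-⇔ λ k → sat-ren (ext-liftR k ρr≗ρ′) A
  sat-ren ρr≗ρ′ (t ∈⊥⊥)  = cong-⇔ Pol (evalT-renT ρr≗ρ′ t)
  sat-ren ρr≗ρ′ (s 𝐓 t)  = cong₂-⇔ Tr (evalT-renT ρr≗ρ′ s) (evalT-renT ρr≗ρ′ t)
  sat-ren ρr≗ρ′ (s 𝐅 t)  = cong₂-⇔ Fa (evalT-renT ρr≗ρ′ s) (evalT-renT ρr≗ρ′ t)

  sat-sub : ∀ {n m} {σ : Fin n → Term m} {ρ ρ′} → evalS σ ρ ≗ ρ′ → ∀ A → Sat M (sub σ A) ρ ⇔ Sat M A ρ′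
  sat-sub σρ≗ρ′ (s ≐ t)  = cong₂-⇔ _≡_ (evalT-subT σρ≗ρ′ s) (evalT-subT σρ≗ρ′ t)
  sat-sub σρ≗ρ′ (A ⇒ B)  = →-cong-⇔ (sat-sub σρ≗ρ′ A) (sat-sub σρ≗ρ′ B)
  sat-sub σρ≗ρ′ (∀' A)   = ∀-cong-⇔ λ k → sat-sub (ext-liftS k σρ≗ρ′) A
  sat-sub σρ≗ρ′ (t ∈⊥⊥)  = cong-⇔ Pol (evalT-subT σρ≗ρ′ t)
  sat-sub σρ≗ρ′ (s 𝐓 t)  = cong₂-⇔ Tr (evalT-subT σρ≗ρ′ s) (evalT-subT σρ≗ρ′ t)
  sat-sub σρ≗ρ′ (s 𝐅 t)  = cong₂-⇔ Fa (evalT-subT σρ≗ρ′ s) (evalT-subT σρ≗ρ′ t)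

  sat-wk0 : ∀ (A : Fm 0) (ρ : Env n) → Sat M (wk0 A) ρ ⇔ Sat M A empty
  sat-wk0 A ρ = sat-ren (λ ()) A

  sat-wk : ∀ (A : Fm n) k ρ → Sat M (wk A) (ext k ρ) ⇔ Sat M A ρ
  sat-wk A k ρ = sat-ren (λ _ → refl) A

  sat-[] : ∀ (A : Fm (suc n)) t ρ → Sat M (A [ t ]) ρ ⇔ Sat M A (ext (evalT t ρ) ρ)
  sat-[] A t ρ = sat-sub (λ { fz → refl ; (fs i) → refl }) A

  sat-stepS : ∀ (A : Fm (suc n)) k ρ → Sat M (stepS A) (ext k ρ) ⇔ Sat M A (ext (suc k) ρ)
  sat-stepS A k ρ = sat-sub (λ { fz → refl ; (fs i) → refl }) A

  sat-⟦⟧ : ∀ {k} (A : Fm k) (ts : Vec (Term n) k) ρ → Sat M (A ⟦ ts ⟧) ρ ⇔ Sat M A (evalS (lookup ts) ρ)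
  sat-⟦⟧ A ts ρ = sat-sub (λ _ → refl) A

IsL-sub : (σ : Fin n → Term m) {A : Fm n} → IsL A → IsL (sub σ A)
IsL-sub σ L≐         = L≐
IsL-sub σ (L⇒ LA LB) = L⇒ (IsL-sub σ LA) (IsL-sub σ LB)
IsL-sub σ (L∀ LA)    = L∀ (IsL-sub (liftS σ) LA)

coded⇔ : (X : Fm 0 → Set) {A : Fm 0} → IsL A → (Σ (Fm 0) λ B → IsL B × ⌜ B ⌝ ≡ ⌜ A ⌝ × X B) ⇔ X A
coded⇔ X {A} LA = mk⇔
  (λ { (B , _ , ⌜B⌝≡⌜A⌝ , x) → subst X (⌜⌝-injective B A ⌜B⌝≡⌜A⌝) x })
  (λ x → A , LA , refl , x)

if-≟⇔ : ∀ x y (X : Set) → (if ⌊ x ≟ y ⌋ then X else ⊤) ⇔ (x ≡ y → X)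
if-≟⇔ x y X with x ≟ y
... | yes x≡y = mk⇔ (λ p _ → p) (λ f → f x≡y)
... | no  x≢y = mk⇔ (λ _ x≡y → ⊥-elim (x≢y x≡y)) (λ _ → tt)

module _ (Pl : ℕ → Set) where
  open Realizability Pl

  ‖≐‖⇔ : ∀ (s t : Term n) ρ k → ‖ s ≐ t ‖ ρ k ⇔ (evalT s ρ ≡ evalT t ρ → Pl k)
  ‖≐‖⇔ s t ρ k = if-≟⇔ (evalT s ρ) (evalT t ρ) (Pl k)

  ‖‖-sub : ∀ {σ : Fin n → Term m} {ρ ρ′} → evalS σ ρ ≗ ρ′ → ∀ A k → ‖ sub σ A ‖ ρ k ⇔ ‖ A ‖ ρ′ k
  ‖‖-sub σρ≗ρ′ (s ≐ t) k =
    cong₂-⇔ (λ x y → if ⌊ x ≟ y ⌋ then Pl k else ⊤) (evalT-subT σρ≗ρ′ s) (evalT-subT σρ≗ρ′ t)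
  ‖‖-sub σρ≗ρ′ (A ⇒ B) k =
    (∀-cong-⇔ λ m → →-cong-⇔ (‖‖-sub σρ≗ρ′ A m) (⇔-id _)) ×-⇔ ‖‖-sub σρ≗ρ′ B (π₁ k)
  ‖‖-sub σρ≗ρ′ (∀' A) k = ‖‖-sub (ext-liftS (π₀ k) σρ≗ρ′) A (π₁ k)
  ‖‖-sub σρ≗ρ′ (t ∈⊥⊥) k = ⇔-id _
  ‖‖-sub σρ≗ρ′ (s 𝐓 t) k = ⇔-id _
  ‖‖-sub σρ≗ρ′ (s 𝐅 t) k = ⇔-id _

  𝕋⇔∣∣ : ∀ {A} a → IsL A → 𝕋 a ⌜ A ⌝ ⇔ ∣ A ∣ empty a
  𝕋⇔∣∣ a = coded⇔ (λ B → ∣ B ∣ empty a)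

  𝔽⇔‖‖ : ∀ {A} a → IsL A → 𝔽 a ⌜ A ⌝ ⇔ ‖ A ‖ empty a
  𝔽⇔‖‖ a = coded⇔ (λ B → ‖ B ‖ empty a)

∅ : ℕ → Set
∅ _ = ⊥

∅-isPole : IsPole ∅
∅-isPole _ _ _ _ ()

-- Sat M (A ⇔̇ B) ρ and Sat M (A ∧̇ B) ρ compute to the types below (⊥̇ is 0 ≐ 1);
-- stating them on types lets Agda infer X and Y.
sat-⇔̇-intro : {X Y : Set} → X ⇔ Y → ((X → Y) → (Y → X) → 0 ≡ 1) → 0 ≡ 1
sat-⇔̇-intro X⇔Y both = both (Equivalence.to X⇔Y) (Equivalence.from X⇔Y)

module _ (em : ExcludedMiddle 0ℓ) where
  private
    dne : {X : Set} → ¬ ¬ X → X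
    dne = em⇒dne em

  sat-∧̇⇔× : {X Y : Set} → ((X → Y → 0 ≡ 1) → 0 ≡ 1) ⇔ (X × Y)
  sat-∧̇⇔× = mk⇔
    (λ h → dne (λ ¬a → 0≢1 (h λ a _ → ⊥-elim (¬a a)))
         , dne (λ ¬b → 0≢1 (h λ _ b → ⊥-elim (¬b b))))
    (λ (a , b) k → k a b)
    where
    0≢1 : 0 ≢ 1
    0≢1 ()

  open Realizability ∅ renaming (‖_‖ to ‖_‖∅; ∣_∣ to ∣_∣∅)

  refutable⇔false : ∀ M {A : Fm n} → IsL A → ∀ ρ → Σ ℕ (‖ A ‖∅ ρ) ⇔ (¬ Sat M A ρ)
  refutable⇔false M (L≐ {s} {t}) ρ = mk⇔
    (λ (k , r) → Equivalence.to (‖≐‖⇔ ∅ s t ρ k) r)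
    (λ s≢t → 0 , Equivalence.from (‖≐‖⇔ ∅ s t ρ 0) s≢t)
  refutable⇔false M {A ⇒ B} (L⇒ LA LB) ρ = mk⇔ refutation⇒false false⇒refutation
    where
    module IHA = Equivalence (refutable⇔false M LA ρ)
    module IHB = Equivalence (refutable⇔false M LB ρ)

    refutation⇒false : Σ ℕ (‖ A ⇒ B ‖∅ ρ) → ¬ Sat M (A ⇒ B) ρ
    refutation⇒false (k , ∣A∣k , ‖B‖k) A→B =
      IHB.to (π₁ k , ‖B‖k) (A→B (dne λ ¬A → let (m , ‖A‖m) = IHA.from ¬A in ∣A∣k m ‖A‖m))

    false⇒refutation : ¬ Sat M (A ⇒ B) ρ → Σ ℕ (‖ A ⇒ B ‖∅ ρ)
    false⇒refutation ¬A→B =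
      let (m , ‖B‖m) = IHB.from λ b → ¬A→B λ _ → b in
      ⟨ 0 , m ⟩ , (λ m′ ‖A‖m′ → IHA.to (m′ , ‖A‖m′) satA)
                , subst (‖ B ‖∅ ρ) (sym (π₁-pair 0 m)) ‖B‖m
      where
      satA : Sat M A ρ
      satA = dne λ ¬A → ¬A→B λ a → ⊥-elim (¬A a)
  refutable⇔false M {∀' A} (L∀ LA) ρ = mk⇔ refutation⇒false false⇒refutation
    where
    IH : ∀ k → Σ ℕ (‖ A ‖∅ (ext k ρ)) ⇔ (¬ Sat M A (ext k ρ))
    IH k = refutable⇔false M LA (ext k ρ)

    refutation⇒false : Σ ℕ (‖ ∀' A ‖∅ ρ) → ¬ Sat M (∀' A) ρ
    refutation⇒false (k , r) ∀A = Equivalence.to (IH (π₀ k)) (π₁ k , r) (∀A (π₀ k))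

    false⇒refutation : ¬ Sat M (∀' A) ρ → Σ ℕ (‖ ∀' A ‖∅ ρ)
    false⇒refutation ¬∀A =
      let (k , ¬Ak) = counterexample
          (m , ‖A‖m) = Equivalence.from (IH k) ¬Ak
      in ⟨ k , m ⟩ , subst (λ (x , y) → ‖ A ‖∅ (ext x ρ) y) (sym (unpair-pair k m)) ‖A‖m
      where
      counterexample : Σ ℕ λ k → ¬ Sat M A (ext k ρ)
      counterexample = dne λ ¬∃ → ¬∀A λ k → dne λ ¬Ak → ¬∃ (k , ¬Ak)

  realizable⇒true : ∀ M {A : Fm 0} → IsL A → Σ ℕ (∣ A ∣∅ empty) → Sat M A empty
  realizable⇒true M LA (a , ∣A∣a) =
    dne λ ¬A → let (m , ‖A‖m) = Equivalence.from (refutable⇔false M LA empty) ¬A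
               in ∣A∣a m ‖A‖m

Eq-codes⇔ : (s t : Term 0) →
  (Σ (Term 0) λ s′ → Σ (Term 0) λ t′ →
     codeT s′ ≡ codeT s × codeT t′ ≡ codeT t × evalT s′ empty ≡ evalT t′ empty)
  ⇔ (evalT s empty ≡ evalT t empty)
Eq-codes⇔ s t = mk⇔
  (λ { (s′ , t′ , s′≡s , t′≡t , e) →
         subst₂ (λ x y → evalT x empty ≡ evalT y empty)
                (codeT-injective s′ s s′≡s) (codeT-injective t′ t t′≡t) e })
  (λ e → s , t , refl , refl , e)

module _ (G : Arith) where
  open Arith G
  open Theory G

  module _ (em : ExcludedMiddle 0ℓ) (M : Str) (crAx-true : ∀ {A} → CRAx A → Sat M A empty) where
    open Equivalence

    ax-sound : Ax n A → ∀ ρ → Sat M A ρ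
    ax-sound (K A B)          ρ a _ = a
    ax-sound (Sax A B C′)     ρ f g a = f a (g a)
    ax-sound (peirce A B)     ρ f = em⇒dne em λ ¬a → ¬a (f λ a → ⊥-elim (¬a a))
    ax-sound (efq A)          ρ ()
    ax-sound (inst A t)       ρ ∀A = from (sat-[] M A t ρ) (∀A (evalT t ρ))
    ax-sound (dist A B)       ρ ∀[A⇒B] a k = ∀[A⇒B] k (from (sat-wk M A k ρ) a)
    ax-sound (refl≐ t)        ρ = refl
    ax-sound (leib A s t)     ρ s≡t As =
      from (sat-[] M A t ρ) (subst (λ x → Sat M A (ext x ρ)) s≡t (to (sat-[] M A s ρ) As))
    ax-sound (succ0 t)        ρ ()
    ax-sound (succI s t)      ρ = suc-injective
    ax-sound (defZ ts)        ρ = refl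
    ax-sound (defP i ts)      ρ = lookup-evalTs ts i ρ
    ax-sound (defC f gs ts)   ρ = cong (evalPR f) (sym (evalTs-map-fn gs ts ρ))
    ax-sound (defR0 g h ts)   ρ = refl
    ax-sound (defRS g h t ts) ρ = refl
    ax-sound (ind A)          ρ A0 step = induction
      where
      induction : ∀ k → Sat M A (ext k ρ)
      induction zero    = to (sat-[] M A (num 0) ρ) A0
      induction (suc k) = to (sat-stepS M A k ρ) (step k (induction k))
    ax-sound (cr {A} axiom)   ρ = from (sat-wk0 M A ρ) (crAx-true axiom)

  module _ (em : ExcludedMiddle 0ℓ) (Pl : ℕ → Set) (isPole : IsPole Pl) where
    open Realizability Pl
    open Equivalence
    open Related.EquationalReasoning

    private
      M : Str
      M = model Pl

    sentence-at : ∀ (t : Term n) {ρ} → Sat M (sentF ⟦ t ∷ [] ⟧) ρ →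
                  Σ (Fm 0) λ A → IsL A × ⌜ A ⌝ ≡ evalT t ρ
    sentence-at t {ρ} h = to (sentF-ok M _) (to (sat-⟦⟧ M sentF (t ∷ []) ρ) h)

    formula₁-at : ∀ (t : Term n) {ρ} → Sat M (sent1F ⟦ t ∷ [] ⟧) ρ →
                  Σ (Fm 1) λ A → IsL A × ⌜ A ⌝ ≡ evalT t ρ
    formula₁-at t {ρ} h = to (sent1F-ok M _) (to (sat-⟦⟧ M sent1F (t ∷ []) ρ) h)

    closed-term-at : ∀ (t : Term n) {ρ} → Sat M (ctmF ⟦ t ∷ [] ⟧) ρ →
                     Σ (Term 0) λ s → codeT s ≡ evalT t ρ
    closed-term-at t {ρ} h = to (ctmF-ok M _) (to (sat-⟦⟧ M ctmF (t ∷ []) ρ) h)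

    crAx-sound : ∀ {A} → CRAx A → Sat M A empty
    crAx-sound ax-pole z y x app z∈⊥⊥ = subst Pl (sym (pairC-ok x y)) (isPole x y z x·y≃z z∈⊥⊥)
      where
      x·y≃z : x · y ≃ z
      x·y≃z = to (appF-ok M _) (to (sat-⟦⟧ M appF (var (# 0) ∷ var (# 1) ∷ var (# 2) ∷ []) _) app)

    crAx-sound ax-T c a isSent
      with A , LA , refl ← sentence-at (var (# 1)) isSent = sat-⇔̇-intro (begin
        𝕋 a ⌜ A ⌝
          ∼⟨ 𝕋⇔∣∣ Pl a LA ⟩
        (∀ b → ‖ A ‖ empty b → Pl ⟨ a , b ⟩)
          ∼⟨ ∀-cong-⇔ (λ b → →-cong-⇔ (⇔-sym (𝔽⇔‖‖ Pl b LA)) (cong-⇔ Pl (sym (pairC-ok a b)))) ⟩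
        (∀ b → 𝔽 b ⌜ A ⌝ → Pl (evalPR pairC (a ∷ b ∷ [])))
          ∎)

    crAx-sound ax-F≐ tc sc a isTm₁ isTm₂
      with s , refl ← closed-term-at (var (# 1)) isTm₁
         | t , refl ← closed-term-at (var (# 2)) isTm₂ = sat-⇔̇-intro (begin
        𝔽 a (evalPR eqC (codeT s ∷ codeT t ∷ []))
          ∼⟨ cong-⇔ (𝔽 a) (eqC-ok s t) ⟩
        𝔽 a ⌜ s ≐ t ⌝
          ∼⟨ 𝔽⇔‖‖ Pl a (L≐ {s = s} {t}) ⟩
        ‖ s ≐ t ‖ empty a
          ∼⟨ ‖≐‖⇔ Pl s t empty a ⟩
        (evalT s empty ≡ evalT t empty → Pl a)
          ∼⟨ →-cong-⇔ (⇔-sym Eq⇔) (⇔-id _) ⟩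
        (Sat M (eqF ⟦ var (# 1) ∷ var (# 2) ∷ [] ⟧) ρ → Pl a)
          ∎)
      where
      ρ = ext a (ext (codeT s) (ext (codeT t) empty))
      Eq⇔ : Sat M (eqF ⟦ var (# 1) ∷ var (# 2) ∷ [] ⟧) ρ ⇔ (evalT s empty ≡ evalT t empty)
      Eq⇔ = Eq-codes⇔ s t ⇔-∘ (eqF-ok M _ ⇔-∘ sat-⟦⟧ M eqF (var (# 1) ∷ var (# 2) ∷ []) ρ)

    crAx-sound ax-F⇒ Bc Ac a isSentA isSentB
      with A , LA , refl ← sentence-at (var (# 1)) isSentA
         | B , LB , refl ← sentence-at (var (# 2)) isSentB = sat-⇔̇-intro (begin
        𝔽 a (evalPR impC (⌜ A ⌝ ∷ ⌜ B ⌝ ∷ []))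
          ∼⟨ cong-⇔ (𝔽 a) (impC-ok A B) ⟩
        𝔽 a ⌜ A ⇒ B ⌝
          ∼⟨ 𝔽⇔‖‖ Pl a (L⇒ LA LB) ⟩
        (∣ A ∣ empty (π₀ a) × ‖ B ‖ empty (π₁ a))
          ∼⟨ ⇔-sym (𝕋⇔∣∣ Pl (π₀ a) LA ×-⇔ 𝔽⇔‖‖ Pl (π₁ a) LB) ⟩
        (𝕋 (π₀ a) ⌜ A ⌝ × 𝔽 (π₁ a) ⌜ B ⌝)
          ∼⟨ cong-⇔ (λ x → 𝕋 x ⌜ A ⌝) (sym (fstC-ok a)) ×-⇔ cong-⇔ (λ y → 𝔽 y ⌜ B ⌝) (sym (sndC-ok a)) ⟩
        (𝕋 (evalPR fstC (a ∷ [])) ⌜ A ⌝ × 𝔽 (evalPR sndC (a ∷ [])) ⌜ B ⌝)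
          ∼⟨ ⇔-sym (sat-∧̇⇔× em) ⟩
        _
          ∎)

    crAx-sound ax-F∀ Ac a isSent₁
      with A , LA , refl ← formula₁-at (var (# 1)) isSent₁ = sat-⇔̇-intro (begin
        𝔽 a (evalPR allC (⌜ A ⌝ ∷ []))
          ∼⟨ cong-⇔ (𝔽 a) (allC-ok A) ⟩
        𝔽 a ⌜ ∀' A ⌝
          ∼⟨ 𝔽⇔‖‖ Pl a (L∀ LA) ⟩
        ‖ A ‖ (ext k empty) (π₁ a)
          ∼⟨ ⇔-sym (‖‖-sub Pl (λ { fz → evalT-num k empty }) A (π₁ a)) ⟩
        ‖ A [ num k ] ‖ empty (π₁ a)
          ∼⟨ ⇔-sym (𝔽⇔‖‖ Pl (π₁ a) (IsL-sub _ LA)) ⟩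
        𝔽 (π₁ a) ⌜ A [ num k ] ⌝
          ∼⟨ cong₂-⇔ 𝔽 (sym (sndC-ok a)) (sym code-of-instance) ⟩
        𝔽 (evalPR sndC (a ∷ [])) (evalPR substC (⌜ A ⌝ ∷ evalPR fstC (a ∷ []) ∷ []))
          ∎)
      where
      k = π₀ a
      code-of-instance : evalPR substC (⌜ A ⌝ ∷ evalPR fstC (a ∷ []) ∷ []) ≡ ⌜ A [ num k ] ⌝
      code-of-instance = trans (cong (λ x → evalPR substC (⌜ A ⌝ ∷ x ∷ [])) (fstC-ok a)) (substC-ok A k)

  sound : ExcludedMiddle 0ℓ → n ⊢ A → (Pl : ℕ → Set) → IsPole Pl → ∀ ρ → Sat (model Pl) A ρ
  sound em (ax a)   Pl isPole ρ = ax-sound em (model Pl) (crAx-sound em Pl isPole) a ρ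
  sound em (mp d e) Pl isPole ρ = sound em d Pl isPole ρ (sound em e Pl isPole ρ)
  sound em (gen d)  Pl isPole ρ k = sound em d Pl isPole (ext k ρ)
  sound em (refl-rule s A LA ⊢sTA) Pl isPole ρ =
    Equivalence.from (sat-wk0 (model Pl) A ρ) (realizable⇒true em (model Pl) LA (evalT s empty , s⊩A))
    where
    sTA-in-∅ : Realizability.𝕋 ∅ (evalT s empty) ⌜ A ⌝
    sTA-in-∅ = subst (Realizability.𝕋 ∅ (evalT s empty)) (evalT-num ⌜ A ⌝ empty)
                     (sound em ⊢sTA ∅ ∅-isPole empty)
    s⊩A : Realizability.∣ ∅ ∣ A empty (evalT s empty)
    s⊩A = Equivalence.to (𝕋⇔∣∣ ∅ (evalT s empty) LA) sTA-in-∅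

proposition5 : ExcludedMiddle 0ℓ → (G : Arith) (A : Fm 0) → Theory.CR⁺⊢ G A →
    (Pl : ℕ → Set) → IsPole Pl → Sat (model Pl) A empty
proposition5 em G A ⊢A Pl isPole = sound G em ⊢A Pl isPole empty
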